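{- Let $n\ge 1$, let $N=\{0,1,\dots,n+1\}$ where $0$ and $n+1$ both denote the depot, let $C=\{1,\dots,n\}$, and let $t_R$ and $t_D$ be truck and drone travel-time functions on pairs of nodes. For every optimal solution $S^*$ of the FSTSP on the instance $(n,N,t_R,t_D)$ there exists a Hamiltonian cycle $h=(v_0,v_1,\dots,v_{n+1})$ over $N$ such that $S^*$ respects $h$.
   Context: FSTSP (Flying Sidekick Traveling Salesman Problem). Customers are $C=\{1,\dots,n\}$; nodes are $N=\{0,\dots,n+1\}$ with $0\equiv n+1$ the depot. An operation is a pair $o=(r,d)$ where $r=(u_1,\dots,u_m)$, $m\ge 2$, is a sequence of nodes (the truck path; its nodes are truck nodes) and $d$ is either empty or a triple $d=(u_1,w,u_m)$ with $w\in C$ a customer (the drone node), $w\neq u_1$, $w\ne u_m$, $u_1\neq u_m$. Its times are $t(r)=\sum_{\ell=1}^{m-1}t_R(u_\ell,u_{\ell+1})$, $t(d)=t_D(u_1,w)+t_D(w,u_m)$, and $t(o)=\max\{t(r),t(d)\}$ if $d$ is nonempty, $t(o)=t(r)$ otherwise. A solution is a sequence $S=(o_1,\dots,o_s)$ of operations $o_\ell=(r_\ell,d_\ell)$ such that the first node of $r_1$ is $0$, the last node of $r_s$ is $n+1$, the depot appears in no other position of any operation, the last node of $r_\ell$ equals the first node of $r_{\ell+1}$ for $\ell<s$, and every customer is served exactly once: either it appears exactly once in the truck route obtained by concatenating $r_1,\dots,r_s$ (identifying the shared endpoint of consecutive paths), or it is the drone node of exactly one operation (and then is not a truck node). Its time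 is $t(S)=\sum_\ell t(o_\ell)$; the FSTSP asks for a solution of minimum time. A Hamiltonian cycle over $N$ is a sequence $h=(v_0,\dots,v_{n+1})$ with $v_0=0$, $v_{n+1}=n+1$ and $(v_1,\dots,v_n)$ a permutation of $C$. A solution $S$ respects $h$ if the truck nodes are visited by the truck route in the relative order in which they appear in $h$, and for every operation with nonempty drone path $(u_1,w,u_m)$, the node $w$ appears in $h$ strictly between $u_1$ and $u_m$.
   Formalization: The truck and drone travel-time functions $t_R$ and $t_D$ take values in the rationals. -}

module Defs where

open import Data.Nat using (ℕ; zero; suc)
open import Data.Fin using (Fin; fromℕ; _<_; _≟_)
open import Data.Fin.Permutation using (Permutation′; _⟨$⟩ʳ_; _⟨$⟩ˡ_)
open import Data.List using (List; []; _∷_; _++_; [_]; length; filter; concatMap; mapMaybe; map; head; last; foldr)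
open import Data.List.Relation.Unary.All using (All)
open import Data.List.Relation.Unary.Linked using (Linked)
open import Data.List.Relation.Unary.AllPairs using (AllPairs)
open import Data.Maybe using (Maybe; just; nothing)
import Data.Maybe as M
open import Data.Product using (_×_; Σ; Σ-syntax; _,_)
open import Data.Unit using (⊤)
open import Data.Sum using (_⊎_)
open import Data.Rational using (ℚ; 0ℚ; _+_; _⊔_; _≤_)
open import Relation.Binary.PropositionalEquality using (_≡_; _≢_)

Node : ℕ → Set
Node n = Fin (suc (suc n))

depot₀ : ∀ {n} → Node n
depot₀ = Fin.zero

depotₑ : ∀ {n} → Node n
depotₑ {n} = fromℕ (suc n)

IsCustomer : ∀ {n} → Node n → Set
IsCustomer v = (v ≢ depot₀) × (v ≢ depotₑ)

-- An operation o = (r, d): truck path r = (start ∷ mid ++ [end]) (so m ≥ 2),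
-- and drone path d either empty (nothing) or (start, w, end) (just w).
record Op (n : ℕ) : Set where
  constructor op
  field
    start : Node n
    mid   : List (Node n)
    end   : Node n
    drone : Maybe (Node n)
open Op public

truckPath : ∀ {n} → Op n → List (Node n)
truckPath o = start o ∷ (mid o ++ [ end o ])

WellFormedOp : ∀ {n} → Op n → Set
WellFormedOp o with drone o
... | nothing = ⊤
... | just w  = IsCustomer w × (w ≢ start o) × (w ≢ end o) × (start o ≢ end o)

module Times {n : ℕ} (tR tD : Node n → Node n → ℚ) where

  walkTime : Node n → List (Node n) → ℚ
  walkTime x []       = 0ℚ
  walkTime x (y ∷ ys) = tR x y + walkTime y ys

  tr : Op n → ℚ
  tr o = walkTime (start o) (mid o ++ [ end o ])

  tOp : Op n → ℚ
  tOp o with drone o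
  ... | nothing = tr o
  ... | just w  = tr o ⊔ (tD (start o) w + tD w (end o))

  tSol : List (Op n) → ℚ
  tSol = foldr (λ o acc → tOp o + acc) 0ℚ

-- Truck route: concatenation of the truck paths, identifying shared endpoints.
truckRoute : ∀ {n} → List (Op n) → List (Node n)
truckRoute []       = []
truckRoute (o ∷ os) = start o ∷ concatMap (λ p → mid p ++ [ end p ]) (o ∷ os)

droneNodes : ∀ {n} → List (Op n) → List (Node n)
droneNodes = mapMaybe drone

occ : ∀ {n} → Node n → List (Node n) → ℕ
occ v xs = length (filter (_≟ v) xs)

IsSolution : ∀ {n} → List (Op n) → Set
IsSolution {n} S =
    (M.map start (head S) ≡ just depot₀)
  × (M.map end (last S) ≡ just depotₑ)
  × Linked (λ o o′ → (end o ≡ start o′) × IsCustomer (end o)) S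
  × All (λ o → All IsCustomer (mid o)) S
  × All WellFormedOp S
  × (∀ (c : Node n) → IsCustomer c →
       ((occ c (truckRoute S) ≡ 1) × (occ c (droneNodes S) ≡ 0))
     ⊎ ((occ c (truckRoute S) ≡ 0) × (occ c (droneNodes S) ≡ 1)))

IsOptimal : ∀ {n} (tR tD : Node n → Node n → ℚ) → List (Op n) → Set
IsOptimal {n} tR tD S = IsSolution S × (∀ (S′ : List (Op n)) → IsSolution S′ → tSol S ≤ tSol S′)
  where open Times tR tD

-- Hamiltonian cycle h = (v₀, ..., v_{n+1}): h ⟨$⟩ʳ i = v_i, a permutation of N
-- fixing 0 and n+1 (so (v₁..vₙ) is a permutation of C).
HamCycle : ℕ → Set
HamCycle n = Σ[ h ∈ Permutation′ (suc (suc n)) ]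
  ((h ⟨$⟩ʳ depot₀) ≡ depot₀) × ((h ⟨$⟩ʳ depotₑ {n}) ≡ depotₑ)

pos : ∀ {n} → HamCycle n → Node n → Fin (suc (suc n))
pos (h , _) v = h ⟨$⟩ˡ v

Respects : ∀ {n} → List (Op n) → HamCycle n → Set
Respects S h =
    AllPairs (λ a b → pos h a < pos h b) (truckRoute S)
  × All (λ o → ∀ w → drone o ≡ just w →
          (pos h (start o) < pos h w) × (pos h w < pos h (end o))) S

-- Interleave the drone nodes into the truck route: every operation contributes its
-- drone node (if any), then its interior truck nodes, then its final node.  Prefixed by
-- the depot 0, this service order lists every node of N exactly once (customers by the
-- service constraint, the depot because all other truck nodes are customers), and it
-- ends with the depot n+1.  Reading off positions in this list gives a Hamiltonian cycle
-- h; the truck route and each drone triple (u₁, w, u_m) are sublists of the service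
-- order, so h respects S.  Neither optimality of S nor n ≥ 1 plays a role.
module Submission where

open import Defs
open import Algebra.Properties.CommutativeSemigroup using (interchange)
open import Data.Empty using (⊥-elim)
open import Data.Fin using (Fin; zero; suc; toℕ; cast; _≟_; _<_)
open import Data.Fin.Permutation using (Permutation′; permutation; _⟨$⟩ʳ_; _⟨$⟩ˡ_)
open import Data.Fin.Properties using (toℕ-fromℕ; toℕ-cast; cast-involutive; cantor-schröder-bernstein)
open import Data.List using (List; []; _∷_; _++_; [_]; length; lookup; last; filter; concatMap; map; fromMaybe)
open import Data.List.Membership.Propositional using (_∈_; _∉_)
open import Data.List.Membership.Propositional.Properties using (∈-lookup)
open import Data.List.Properties using (++-assoc; ++-identityʳ; filter-++; length-++; tabulate-lookup; catMaybes-concatMap; concatMap-map)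
open import Data.List.Relation.Binary.Sublist.Propositional using (_⊆_; []; _∷_; _∷ʳ_; ⊆-refl; ⊆-trans; ⊆-reflexive)
open import Data.List.Relation.Binary.Sublist.Propositional.Properties using (All-resp-⊆; ++⁺; ++⁺ˡ; ++⁺ʳ)
open import Data.List.Relation.Unary.All as All using (All; []; _∷_)
open import Data.List.Relation.Unary.All.Properties using (¬Any⇒All¬) renaming (++⁺ to All-++⁺)
open import Data.List.Relation.Unary.AllPairs using (AllPairs; []; _∷_)
open import Data.List.Relation.Unary.AllPairs.Properties using (tabulate⁺-<)
open import Data.List.Relation.Unary.Any using (here; there)
import Data.List.Relation.Unary.Any as Any
import Data.List.Relation.Unary.Any.Properties as Any
open import Data.List.Relation.Unary.Linked using (Linked; [-]; _∷_)
open import Data.List.Relation.Unary.Unique.Propositional using (Unique)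
open import Data.Maybe using (just; nothing)
import Data.Maybe as Maybe
open import Data.Maybe.Properties using (just-injective)
open import Data.Nat as ℕ using (ℕ; suc; _+_; _≤_)
open import Data.Nat.Properties using (suc-injective; +-commutativeSemigroup; 1+n≢0; m≤n+m; ≤-trans; ≤-reflexive; n≤0⇒n≡0)
open import Data.Product using (Σ-syntax; _×_; _,_; proj₁; proj₂)
open import Data.Rational using (ℚ)
open import Data.Sum using (_⊎_; inj₁; inj₂)
open import Function using (_∘_)
open import Relation.Nullary using (yes; no)
open import Relation.Binary.PropositionalEquality hiding ([_])

module _ {A : Set} where

  AllPairs-resp-⊇ : ∀ {R : A → A → Set} {xs ys} → xs ⊆ ys → AllPairs R ys → AllPairs R xs
  AllPairs-resp-⊇ []         []         = []
  AllPairs-resp-⊇ (_ ∷ʳ τ)   (_ ∷ pys)  = AllPairs-resp-⊇ τ pys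
  AllPairs-resp-⊇ (refl ∷ τ) (px ∷ pys) = All-resp-⊆ τ px ∷ AllPairs-resp-⊇ τ pys

  lookup-injective : ∀ {xs : List A} → Unique xs → ∀ {i j} → lookup xs i ≡ lookup xs j → i ≡ j
  lookup-injective (_ ∷ _)    {zero}  {zero}  _  = refl
  lookup-injective (x∉ ∷ _)   {zero}  {suc j} eq = ⊥-elim (All.lookup x∉ (∈-lookup j) eq)
  lookup-injective (x∉ ∷ _)   {suc i} {zero}  eq = ⊥-elim (All.lookup x∉ (∈-lookup i) (sym eq))
  lookup-injective (_ ∷ uniq) {suc i} {suc j} eq = cong suc (lookup-injective uniq eq)

  lookup-last : ∀ (xs : List A) (i : Fin (length xs)) → suc (toℕ i) ≡ length xs → last xs ≡ just (lookup xs i)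
  lookup-last (x ∷ [])     zero    _  = refl
  lookup-last (x ∷ y ∷ ys) zero    ()
  lookup-last (x ∷ y ∷ ys) (suc i) eq = lookup-last (y ∷ ys) i (suc-injective eq)

  last-∷-snoc : ∀ (x : A) xs y → last (x ∷ xs ++ [ y ]) ≡ just y
  last-∷-snoc x []        y = refl
  last-∷-snoc x (x′ ∷ xs) y = last-∷-snoc x′ xs y

  snoc-⊆ : ∀ (xs : List A) y zs → y ∷ zs ⊆ (xs ++ [ y ]) ++ zs
  snoc-⊆ xs y zs = ⊆-trans (++⁺ˡ xs ⊆-refl) (⊆-reflexive (sym (++-assoc xs [ y ] zs)))

  AllPairs-triple : ∀ {R : A → A → Set} {a b c} → AllPairs R (a ∷ b ∷ c ∷ []) → R a b × R b c
  AllPairs-triple ((a<b ∷ _) ∷ (b<c ∷ []) ∷ _) = a<b , b<c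

module Enumeration {K : ℕ} (L : List (Fin K)) (unique : Unique L) (complete : ∀ v → v ∈ L) where

  index : Fin K → Fin (length L)
  index v = Any.index (complete v)

  lookup-index : ∀ v → lookup L (index v) ≡ v
  lookup-index v = sym (Any.lookup-index (complete v))

  index-lookup : ∀ i → index (lookup L i) ≡ i
  index-lookup i = lookup-injective unique (lookup-index (lookup L i))

  length-L : length L ≡ K
  length-L = cantor-schröder-bernstein (lookup-injective unique) index-injective
    where
    index-injective : ∀ {u v} → index u ≡ index v → u ≡ v
    index-injective {u} {v} eq = trans (sym (lookup-index u)) (trans (cong (lookup L) eq) (lookup-index v))

  enumeration : Permutation′ K
  enumeration = permutation (λ i → lookup L (cast (sym length-L) i)) (λ v → cast length-L (index v))
    (λ v → trans (cong (lookup L) (cast-involutive (sym length-L) length-L (index v))) (lookup-index v))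
    (λ i → trans (cong (cast length-L) (index-lookup _)) (cast-involutive length-L (sym length-L) i))

  toℕ-position-lookup : ∀ i → toℕ (enumeration ⟨$⟩ˡ lookup L i) ≡ toℕ i
  toℕ-position-lookup i = trans (toℕ-cast length-L _) (cong toℕ (index-lookup i))

  enumeration-ordered : AllPairs (λ a b → enumeration ⟨$⟩ˡ a < enumeration ⟨$⟩ˡ b) L
  enumeration-ordered = subst (AllPairs _) (tabulate-lookup L) (tabulate⁺-< increasing)
    where
    increasing : ∀ {i j} → i < j → enumeration ⟨$⟩ˡ lookup L i < enumeration ⟨$⟩ˡ lookup L j
    increasing {i} {j} = subst₂ ℕ._<_ (sym (toℕ-position-lookup i)) (sym (toℕ-position-lookup j))

  enumeration-last : ∀ {y} (i : Fin K) → suc (toℕ i) ≡ K → last L ≡ just y → enumeration ⟨$⟩ʳ i ≡ y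
  enumeration-last i i-last L-last = just-injective (trans (sym (lookup-last L _ i′-last)) L-last)
    where
    i′-last : suc (toℕ (cast (sym length-L) i)) ≡ length L
    i′-last = trans (cong suc (toℕ-cast _ i)) (trans i-last (sym length-L))

module _ {n : ℕ} where

  occ-++ : ∀ (v : Node n) xs ys → occ v (xs ++ ys) ≡ occ v xs + occ v ys
  occ-++ v xs ys = trans (cong length (filter-++ (_≟ v) xs ys)) (length-++ (filter (_≟ v) xs))

  occ-self : ∀ (v : Node n) → occ v [ v ] ≡ 1
  occ-self v with v ≟ v
  ... | yes _  = refl
  ... | no v≢v = ⊥-elim (v≢v refl)

  occ-absent : ∀ (v : Node n) xs → All (_≢ v) xs → occ v xs ≡ 0
  occ-absent v []       []          = refl
  occ-absent v (x ∷ xs) (x≢v ∷ x≢s) with x ≟ v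
  ... | yes x≡v = ⊥-elim (x≢v x≡v)
  ... | no _    = occ-absent v xs x≢s

  occ-∷-≢ : ∀ {v x : Node n} xs → x ≢ v → occ v (x ∷ xs) ≡ occ v xs
  occ-∷-≢ {v} {x} xs x≢v = trans (occ-++ v [ x ] xs) (cong (_+ occ v xs) (occ-absent v [ x ] (x≢v ∷ [])))

  occ≡0⇒∉ : ∀ {v : Node n} xs → occ v xs ≡ 0 → v ∉ xs
  occ≡0⇒∉ {v} (x ∷ xs) eq v∈ with x ≟ v | v∈
  ... | yes _   | _           = 1+n≢0 eq
  ... | no x≢v  | here v≡x    = x≢v (sym v≡x)
  ... | no _    | there v∈xs  = occ≡0⇒∉ xs eq v∈xs

  occ≡1⇒∈ : ∀ {v : Node n} xs → occ v xs ≡ 1 → v ∈ xs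
  occ≡1⇒∈ {v} (x ∷ xs) eq with x ≟ v
  ... | yes x≡v = here (sym x≡v)
  ... | no _    = there (occ≡1⇒∈ xs eq)

  occ≤1⇒Unique : ∀ (xs : List (Node n)) → (∀ v → occ v xs ≤ 1) → Unique xs
  occ≤1⇒Unique []       _     = []
  occ≤1⇒Unique (x ∷ xs) occ≤1 = ¬Any⇒All¬ xs (occ≡0⇒∉ xs x-once) ∷ occ≤1⇒Unique xs occ-tail≤1
    where
    x-once : occ x xs ≡ 0
    x-once = n≤0⇒n≡0 (ℕ.s≤s⁻¹ (subst (_≤ 1) (trans (occ-++ x [ x ] xs) (cong (_+ occ x xs) (occ-self x))) (occ≤1 x)))
    occ-tail≤1 : ∀ v → occ v xs ≤ 1
    occ-tail≤1 v = ≤-trans (m≤n+m (occ v xs) (occ v [ x ])) (subst (_≤ 1) (occ-++ v [ x ] xs) (occ≤1 v))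

  occ-concatMap-++ : ∀ {B : Set} (v : Node n) (f g : B → List (Node n)) bs →
    occ v (concatMap (λ b → f b ++ g b) bs) ≡ occ v (concatMap f bs) + occ v (concatMap g bs)
  occ-concatMap-++ v f g []       = refl
  occ-concatMap-++ v f g (b ∷ bs) = begin
      occ v ((f b ++ g b) ++ concatMap (λ b → f b ++ g b) bs)
    ≡⟨ occ-++ v (f b ++ g b) _ ⟩
      occ v (f b ++ g b) + occ v (concatMap (λ b → f b ++ g b) bs)
    ≡⟨ cong₂ _+_ (occ-++ v (f b) (g b)) (occ-concatMap-++ v f g bs) ⟩
      (occ v (f b) + occ v (g b)) + (occ v (concatMap f bs) + occ v (concatMap g bs))
    ≡⟨ interchange +-commutativeSemigroup (occ v (f b)) (occ v (g b)) _ _ ⟩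
      (occ v (f b) + occ v (concatMap f bs)) + (occ v (g b) + occ v (concatMap g bs))
    ≡⟨ sym (cong₂ _+_ (occ-++ v (f b) _) (occ-++ v (g b) _)) ⟩
      occ v (concatMap f (b ∷ bs)) + occ v (concatMap g (b ∷ bs))
    ∎
    where open ≡-Reasoning

  leg : Op n → List (Node n)
  leg o = mid o ++ [ end o ]

  visit : Op n → List (Node n)
  visit o = fromMaybe (drone o) ++ leg o

  serviceOrder : List (Op n) → List (Node n)
  serviceOrder S = depot₀ ∷ concatMap visit S

  Chained : List (Op n) → Set
  Chained = Linked (λ o o′ → (end o ≡ start o′) × IsCustomer (end o))

  droneNodes≡ : ∀ (S : List (Op n)) → droneNodes S ≡ concatMap (fromMaybe ∘ drone) S
  droneNodes≡ S = trans (catMaybes-concatMap (map drone S)) (concatMap-map fromMaybe drone S)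

  drone-customer : ∀ (o : Op n) → WellFormedOp o → All IsCustomer (fromMaybe (drone o))
  drone-customer o wf with drone o
  ... | nothing = []
  ... | just w  = proj₁ wf ∷ []

  visits-snoc-depot : ∀ o os →
    All (All IsCustomer ∘ fromMaybe ∘ drone) (o ∷ os) → All (All IsCustomer ∘ mid) (o ∷ os) →
    Chained (o ∷ os) → Maybe.map end (last (o ∷ os)) ≡ just depotₑ →
    Σ[ ys ∈ List (Node n) ] All IsCustomer ys × concatMap visit (o ∷ os) ≡ ys ++ [ depotₑ ]
  visits-snoc-depot o [] (ds ∷ []) (ms ∷ []) _ last≡ =
    fromMaybe (drone o) ++ mid o , All-++⁺ ds ms ,
    trans (++-identityʳ (visit o))
      (trans (sym (++-assoc (fromMaybe (drone o)) (mid o) [ end o ]))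
             (cong (λ e → (fromMaybe (drone o) ++ mid o) ++ [ e ]) (just-injective last≡)))
  visits-snoc-depot o (o′ ∷ os) (ds ∷ dss) (ms ∷ mss) ((_ , end-customer) ∷ chained) last≡
    with visits-snoc-depot o′ os dss mss chained last≡
  ... | ys , ys-customers , eq =
    visit o ++ ys , All-++⁺ (All-++⁺ ds (All-++⁺ ms (end-customer ∷ []))) ys-customers ,
    trans (cong (visit o ++_) eq) (sym (++-assoc (visit o) ys [ depotₑ ]))

  legs-⊆-visits : ∀ S → concatMap leg S ⊆ concatMap visit S
  legs-⊆-visits []       = []
  legs-⊆-visits (o ∷ os) = ++⁺ (++⁺ˡ (fromMaybe (drone o)) ⊆-refl) (legs-⊆-visits os)

  drone-triple-⊆ : ∀ o {w} → drone o ≡ just w → start o ∷ w ∷ end o ∷ [] ⊆ start o ∷ visit o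
  drone-triple-⊆ o drone≡ rewrite drone≡ = refl ∷ refl ∷ ++⁺ˡ (mid o) ⊆-refl

  start∷visit-⊆ : ∀ {x} o os → start o ≡ x → Chained (o ∷ os) →
    All (λ p → start p ∷ visit p ⊆ x ∷ concatMap visit (o ∷ os)) (o ∷ os)
  start∷visit-⊆ o []         refl [-] = (refl ∷ ++⁺ʳ [] ⊆-refl) ∷ []
  start∷visit-⊆ o (o′ ∷ os) refl ((end≡start , _) ∷ chained) =
    (refl ∷ ++⁺ʳ _ ⊆-refl) ∷ All.map (λ τ → ⊆-trans τ end∷rest-⊆) (start∷visit-⊆ o′ os (sym end≡start) chained)
    where
    rest : List (Node n)
    rest = concatMap visit (o′ ∷ os)
    end∷rest-⊆ : end o ∷ rest ⊆ start o ∷ visit o ++ rest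
    end∷rest-⊆ = start o ∷ʳ ⊆-trans (++⁺ˡ (fromMaybe (drone o)) (snoc-⊆ (mid o) (end o) rest))
                                     (⊆-reflexive (sym (++-assoc (fromMaybe (drone o)) (leg o) rest)))

  occ-visits : ∀ (v : Node n) S → occ v (concatMap visit S) ≡ occ v (droneNodes S) + occ v (concatMap leg S)
  occ-visits v S = trans (occ-concatMap-++ v (fromMaybe ∘ drone) leg S)
                         (cong (λ ds → occ v ds + occ v (concatMap leg S)) (sym (droneNodes≡ S)))

  occ-∷-snoc : ∀ (v x : Node n) ys y → occ v (x ∷ ys ++ [ y ]) ≡ occ v [ x ] + (occ v ys + occ v [ y ])
  occ-∷-snoc v x ys y = trans (occ-++ v [ x ] (ys ++ [ y ])) (cong (occ v [ x ] +_) (occ-++ v ys [ y ]))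

  occ-depots : ∀ ys → All IsCustomer ys →
    (occ depot₀ (depot₀ ∷ ys ++ [ depotₑ ]) ≡ 1) × (occ depotₑ (depot₀ ∷ ys ++ [ depotₑ ]) ≡ 1)
  occ-depots ys customers =
    trans (occ-∷-snoc depot₀ depot₀ ys depotₑ)
          (cong₂ _+_ (occ-self depot₀)
                     (cong₂ _+_ (occ-absent depot₀ ys (All.map proj₁ customers))
                                (occ-absent depot₀ [ depotₑ ] ((λ ()) ∷ [])))) ,
    trans (occ-∷-snoc depotₑ depot₀ ys depotₑ)
          (cong₂ _+_ (occ-absent depotₑ [ depot₀ ] ((λ ()) ∷ []))
                     (cong₂ _+_ (occ-absent depotₑ ys (All.map proj₂ customers))
                                (occ-self depotₑ)))

module Solution {n : ℕ} (o : Op n) (os : List (Op n)) (sol : IsSolution (o ∷ os)) where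

  private
    S : List (Op n)
    S = o ∷ os

    start≡depot : start o ≡ depot₀
    start≡depot = just-injective (proj₁ sol)

    chained : Chained S
    chained = proj₁ (proj₂ (proj₂ sol))

    served : ∀ c → IsCustomer c →
      ((occ c (truckRoute S) ≡ 1) × (occ c (droneNodes S) ≡ 0)) ⊎ ((occ c (truckRoute S) ≡ 0) × (occ c (droneNodes S) ≡ 1))
    served = proj₂ (proj₂ (proj₂ (proj₂ (proj₂ sol))))

    shape : Σ[ ys ∈ List (Node n) ] All IsCustomer ys × concatMap visit S ≡ ys ++ [ depotₑ ]
    shape = visits-snoc-depot o os (All.map (drone-customer _) (proj₁ (proj₂ (proj₂ (proj₂ (proj₂ sol))))))
                              (proj₁ (proj₂ (proj₂ (proj₂ sol)))) chained (proj₁ (proj₂ sol))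

    ys : List (Node n)
    ys = proj₁ shape

    ys-customers : All IsCustomer ys
    ys-customers = proj₁ (proj₂ shape)

    serviceOrder≡ : serviceOrder S ≡ depot₀ ∷ ys ++ [ depotₑ ]
    serviceOrder≡ = cong (depot₀ ∷_) (proj₂ (proj₂ shape))

  serviceOrder-last : last (serviceOrder S) ≡ just depotₑ
  serviceOrder-last = trans (cong last serviceOrder≡) (last-∷-snoc depot₀ ys depotₑ)

  serviceOrder-once : ∀ v → occ v (serviceOrder S) ≡ 1
  serviceOrder-once v with v ≟ depot₀ | v ≟ depotₑ
  ... | yes refl | _        = trans (cong (occ v) serviceOrder≡) (proj₁ (occ-depots ys ys-customers))
  ... | no _     | yes refl = trans (cong (occ v) serviceOrder≡) (proj₂ (occ-depots ys ys-customers))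
  ... | no v≢depot₀ | no v≢depotₑ = begin
      occ v (serviceOrder S)
    ≡⟨ occ-∷-≢ (concatMap visit S) (v≢depot₀ ∘ sym) ⟩
      occ v (concatMap visit S)
    ≡⟨ occ-visits v S ⟩
      occ v (droneNodes S) + occ v (concatMap leg S)
    ≡⟨ cong (occ v (droneNodes S) +_) (sym (occ-∷-≢ (concatMap leg S) start≢v)) ⟩
      occ v (droneNodes S) + occ v (truckRoute S)
    ≡⟨ served-once (served v (v≢depot₀ , v≢depotₑ)) ⟩
      1
    ∎
    where
    open ≡-Reasoning
    start≢v : start o ≢ v
    start≢v start≡v = v≢depot₀ (trans (sym start≡v) start≡depot)
    served-once : ∀ {t d} → ((t ≡ 1) × (d ≡ 0)) ⊎ ((t ≡ 0) × (d ≡ 1)) → d + t ≡ 1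
    served-once (inj₁ (refl , refl)) = refl
    served-once (inj₂ (refl , refl)) = refl

  truckRoute-⊆ : truckRoute S ⊆ serviceOrder S
  truckRoute-⊆ = start≡depot ∷ legs-⊆-visits S

  drone-triples-⊆ : All (λ p → ∀ w → drone p ≡ just w → start p ∷ w ∷ end p ∷ [] ⊆ serviceOrder S) S
  drone-triples-⊆ = All.map (λ τ w drone≡ → ⊆-trans (drone-triple-⊆ _ drone≡) τ)
                            (start∷visit-⊆ o os start≡depot chained)

lemma1 : (n : ℕ) → 1 ≤ n → (tR tD : Node n → Node n → ℚ) → (S* : List (Op n)) →
    IsOptimal tR tD S* → Σ[ h ∈ HamCycle n ] Respects S* h
lemma1 n _ tR tD []       ((() , _) , _)
lemma1 n _ tR tD (o ∷ os) (sol , _) =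
  -- the service order starts with depot₀, so position 0 holds it by computation
  (enumeration , refl , enumeration-last depotₑ (cong suc (toℕ-fromℕ (suc n))) serviceOrder-last) ,
  AllPairs-resp-⊇ truckRoute-⊆ enumeration-ordered ,
  All.map (λ triple-⊆ w drone≡ → AllPairs-triple (AllPairs-resp-⊇ (triple-⊆ w drone≡) enumeration-ordered))
          drone-triples-⊆
  where
  open Solution o os sol
  open Enumeration (serviceOrder (o ∷ os)) (occ≤1⇒Unique _ (≤-reflexive ∘ serviceOrder-once))
                   (λ v → occ≡1⇒∈ _ (serviceOrder-once v))
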